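{- For every bridgeless graph $G$ with at least one edge, $\eta(G)\leq\zeta(G)$.
   Context: Graphs are finite and simple; bridgeless means no cut-edge. $\eta(G)$ is the smallest integer such that every edge of $G$ belongs to a cycle of length at most $\eta(G)$. A subgraph $H$ of $G$ is isometric if $d_H(x,y)=d_G(x,y)$ for all $x,y\in V(H)$; $\zeta(G)$ is the length of a largest isometric cycle of $G$. -}

module Defs where

open import Level using (0ℓ)
open import Data.Nat using (ℕ; zero; suc; _+_; _≤_; _∸_; NonZero)
open import Data.Nat.DivMod using (_mod_)
open import Data.Fin using (Fin; toℕ)
open import Data.Product using (Σ; ∃; _×_; _,_)
open import Data.Sum using (_⊎_)
open import Data.Empty using (⊥)
open import Relation.Nullary using (¬_)
open import Relation.Binary.PropositionalEquality using (_≡_; _≢_)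
open import Function.Definitions using (Injective)

record Graph (n : ℕ) : Set₁ where
  field
    Adj    : Fin n → Fin n → Set
    sym    : ∀ {x y} → Adj x y → Adj y x
    irrefl : ∀ {x} → ¬ Adj x x
open Graph public

data Walk {n : ℕ} (R : Fin n → Fin n → Set) : Fin n → Fin n → ℕ → Set where
  [] : ∀ {x} → Walk R x x zero
  _∷_ : ∀ {x y z k} → R x y → Walk R y z k → Walk R x z (suc k)

-- d_R(x,y) = d : there is a walk of length d and no shorter one.
-- (If x,y are in different components, no d satisfies this: distance ∞.)
IsDist : {n : ℕ} → (Fin n → Fin n → Set) → Fin n → Fin n → ℕ → Set
IsDist R x y d = Walk R x y d × (∀ m → Walk R x y m → d ≤ m)

HasEdge : {n : ℕ} → Graph n → Set
HasEdge G = Σ _ λ u → Σ _ λ v → Adj G u v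

Delete : {n : ℕ} → Graph n → Fin n → Fin n → Fin n → Fin n → Set
Delete G u v x y = Adj G x y × ¬ ((x ≡ u × y ≡ v) ⊎ (x ≡ v × y ≡ u))

-- uv is a bridge (cut-edge): an edge whose deletion disconnects u from v
-- (equivalently, increases the number of components).
IsBridge : {n : ℕ} → Graph n → Fin n → Fin n → Set
IsBridge G u v = Adj G u v × (∀ k → ¬ Walk (Delete G u v) u v k)

Bridgeless : {n : ℕ} → Graph n → Set
Bridgeless G = ∀ u v → ¬ IsBridge G u v

next : {m : ℕ} → Fin (suc m) → Fin (suc m)
next {m} i = suc (toℕ i) mod (suc m)

record Cycle {n : ℕ} (G : Graph n) (k : ℕ) : Set where
  field
    m      : ℕ
    len    : k ≡ suc m
    three  : 3 ≤ k
    vert   : Fin (suc m) → Fin n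
    inj    : Injective _≡_ _≡_ vert
    adj    : ∀ i → Adj G (vert i) (vert (next i))
open Cycle public

CycVert : {n : ℕ} {G : Graph n} {k : ℕ} → Cycle G k → Fin n → Set
CycVert C x = ∃ λ i → vert C i ≡ x

CycEdge : {n : ℕ} {G : Graph n} {k : ℕ} → Cycle G k → Fin n → Fin n → Set
CycEdge C x y = ∃ λ i → (vert C i ≡ x × vert C (next i) ≡ y)
                       ⊎ (vert C i ≡ y × vert C (next i) ≡ x)

OnCycle : {n : ℕ} {G : Graph n} {k : ℕ} → Cycle G k → Fin n → Fin n → Set
OnCycle C u v = CycEdge C u v

Isometric : {n : ℕ} {G : Graph n} {k : ℕ} → Cycle G k → Set
Isometric {G = G} C =
  ∀ x y → CycVert C x → CycVert C y →
    ∀ d → (IsDist (CycEdge C) x y d → IsDist (Adj G) x y d)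
        × (IsDist (Adj G) x y d → IsDist (CycEdge C) x y d)

EdgesInCyclesUpTo : {n : ℕ} → Graph n → ℕ → Set
EdgesInCyclesUpTo G t =
  ∀ u v → Adj G u v → Σ ℕ λ k → k ≤ t × Σ (Cycle G k) λ C → OnCycle C u v

IsEta : {n : ℕ} → Graph n → ℕ → Set
IsEta G t = EdgesInCyclesUpTo G t × (∀ s → EdgesInCyclesUpTo G s → t ≤ s)

IsZeta : {n : ℕ} → Graph n → ℕ → Set
IsZeta G L = Σ (Cycle G L) Isometric
           × (∀ k → (C : Cycle G k) → Isometric C → k ≤ L)

module Submission where

-- Let uv be an edge.  As uv is not a bridge, u and v are joined by a walk in
-- G − uv; let P = p 0, p 1, …, p D be a shortest one.  Closing P with uv gives
-- a cycle C of length D + 1 through uv, and C is isometric.  Indeed, P is a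
-- geodesic of G − uv (a shorter detour between two of its vertices could be
-- spliced into P), so a stretch of a walk in G − uv from p a to p b is no
-- shorter than the arc of C from p a to p b; a walk in G between vertices of C
-- is cut at its uses of uv into such stretches, each of which is replaced by an
-- arc, the uses of uv by the closing edge of C.  Hence every edge lies on an
-- isometric cycle, of length at most ζ(G), and η(G) ≤ ζ(G) by minimality of η.
--
-- Adjacency is an arbitrary relation, so a shortest detour exists only under
-- double negation; the goal t ≤ L is decidable, so we argue in the
-- double-negation monad and escape at the end.

open import Defs
open import Level using (0ℓ)
open import Data.Nat using (ℕ; zero; suc; _+_; _∸_; _≤_; _<_; z≤n; s≤s; _≤?_)
open import Data.Nat.Properties
open import Data.Nat.DivMod using (_%_; m<n⇒m%n≡m; n%n≡0)
open import Data.Nat.Induction using (<-rec)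
open import Data.Fin using (Fin; toℕ; fromℕ<; fromℕ)
open import Data.Fin.Properties
  using (toℕ-injective; toℕ≤pred[n]; toℕ-fromℕ<; toℕ-fromℕ) renaming (_≟_ to _≟ᶠ_)
open import Data.Product using (Σ; _×_; _,_; proj₁; proj₂)
open import Data.Sum using (_⊎_; inj₁; inj₂)
open import Data.Empty using (⊥-elim)
open import Effect.Monad using (RawMonad)
open import Relation.Nullary using (¬_; Dec; yes; no)
open import Relation.Nullary.Negation using (¬¬-Monad; ¬¬-map)
open import Relation.Nullary.Decidable using (_×-dec_; _⊎-dec_; decidable-stable; ¬¬-excluded-middle)
open import Relation.Binary.PropositionalEquality
  using (_≡_; _≢_; refl; cong; subst; subst₂) renaming (sym to ≡-sym; trans to ≡-trans)
open import Relation.Binary.Definitions using (tri<; tri≈; tri>)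

module _ {n : ℕ} {R : Fin n → Fin n → Set} where

  infixr 5 _++ʷ_

  _++ʷ_ : ∀ {x y z a b} → Walk R x y a → Walk R y z b → Walk R x z (a + b)
  [] ++ʷ V = V
  (e ∷ U) ++ʷ V = e ∷ (U ++ʷ V)

  snoc : ∀ {x y z k} → Walk R x y k → R y z → Walk R x z (suc k)
  snoc [] e = e ∷ []
  snoc (f ∷ U) e = f ∷ snoc U e

  reverse : (∀ {a b} → R a b → R b a) → ∀ {x y k} → Walk R x y k → Walk R y x k
  reverse s [] = []
  reverse s (e ∷ U) = snoc (reverse s U) (s e)

  -- The i-th vertex of a walk (its last vertex once i exceeds the length).
  vertex : ∀ {x y k} → Walk R x y k → ℕ → Fin n
  vertex {x} [] _ = x
  vertex {x} (e ∷ U) zero = x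
  vertex (e ∷ U) (suc i) = vertex U i

  vertex-first : ∀ {x y k} (U : Walk R x y k) → vertex U 0 ≡ x
  vertex-first [] = refl
  vertex-first (e ∷ U) = refl

  vertex-last : ∀ {x y k} (U : Walk R x y k) → vertex U k ≡ y
  vertex-last [] = refl
  vertex-last (e ∷ U) = vertex-last U

  vertex-step : ∀ {x y k} (U : Walk R x y k) i → i < k → R (vertex U i) (vertex U (suc i))
  vertex-step (e ∷ U) zero _ = subst (R _) (≡-sym (vertex-first U)) e
  vertex-step (e ∷ U) (suc i) (s≤s i<k) = vertex-step U i i<k

  prefix : ∀ {x y k} (U : Walk R x y k) i → i ≤ k → Walk R x (vertex U i) i
  prefix U zero _ = subst (λ z → Walk R _ z 0) (≡-sym (vertex-first U)) []
  prefix (e ∷ U) (suc i) (s≤s i≤k) = e ∷ prefix U i i≤k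

  suffix : ∀ {x y k} (U : Walk R x y k) j → j ≤ k → Walk R (vertex U j) y (k ∸ j)
  suffix U zero _ = subst (λ z → Walk R z _ _) (≡-sym (vertex-first U)) U
  suffix (e ∷ U) (suc j) (s≤s j≤k) = suffix U j j≤k

map-walk : ∀ {n} {R S : Fin n → Fin n → Set} → (∀ {a b} → S a b → R a b) →
           ∀ {x y k} → Walk S x y k → Walk R x y k
map-walk f [] = []
map-walk f (e ∷ U) = f e ∷ map-walk f U

WalkWithin : {n : ℕ} → (Fin n → Fin n → Set) → Fin n → Fin n → ℕ → Set
WalkWithin R x y q = Σ ℕ λ ℓ → ℓ ≤ q × Walk R x y ℓ

distance-transfer : ∀ {n} {R S : Fin n → Fin n → Set} → (∀ {a b} → S a b → R a b) →
  ∀ {x y} → (∀ {m} → Walk R x y m → WalkWithin S x y m) →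
  ∀ d → (IsDist S x y d → IsDist R x y d) × (IsDist R x y d → IsDist S x y d)
distance-transfer {R = R} {S} S⊆R {x} {y} shorten d = S⇒R , R⇒S
  where
  S⇒R : IsDist S x y d → IsDist R x y d
  S⇒R (W , least) = map-walk S⊆R W , λ m U →
    let (ℓ , ℓ≤m , W′) = shorten U in ≤-trans (least ℓ W′) ℓ≤m
  R⇒S : IsDist R x y d → IsDist S x y d
  R⇒S (U , least) with shorten U
  ... | ℓ , ℓ≤d , W = subst (Walk S x y) (≤-antisym ℓ≤d (least ℓ (map-walk S⊆R W))) W
                    , λ m W′ → least m (map-walk S⊆R W′)

open RawMonad (¬¬-Monad {0ℓ}) using (pure; _>>=_)

¬¬-→ : ∀ {A B : Set} → (A → ¬ ¬ B) → ¬ ¬ (A → B)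
¬¬-→ f k = k (λ a → ⊥-elim (f a (λ b → k (λ _ → b))))

¬¬-Π-Fin : ∀ m {P : Fin m → Set} → (∀ i → ¬ ¬ P i) → ¬ ¬ (∀ i → P i)
¬¬-Π-Fin zero f = pure λ ()
¬¬-Π-Fin (suc m) f = do
  p₀ ← f Fin.zero
  pₛ ← ¬¬-Π-Fin m (λ i → f (Fin.suc i))
  pure λ { Fin.zero → p₀ ; (Fin.suc i) → pₛ i }
  where import Data.Fin as Fin

¬¬-least : (P : ℕ → Set) → ∀ w → P w → ¬ ¬ (Σ ℕ λ j → P j × (∀ m → P m → j ≤ m))
¬¬-least P = <-rec (λ w → P w → ¬ ¬ (Σ ℕ λ j → P j × (∀ m → P m → j ≤ m))) λ w smaller pw → do
  yes (m , m<w , pm) ← ¬¬-excluded-middle {A = Σ ℕ λ m → m < w × P m}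
    where no none → pure (w , pw , λ m pm → ≮⇒≥ (λ m<w → none (m , m<w , pm)))
  smaller m<w pm

delete-sym : ∀ {n} (G : Graph n) {u v x y} → Delete G u v x y → Delete G u v y x
delete-sym G (xy , not-uv) = sym G xy , λ
  { (inj₁ (y≡u , x≡v)) → not-uv (inj₂ (x≡v , y≡u))
  ; (inj₂ (y≡v , x≡u)) → not-uv (inj₁ (x≡u , y≡v)) }

-- A u–v walk avoiding the edge uv has length at least 2.
detour-length≥2 : ∀ {n} (G : Graph n) {u v k} → Adj G u v → Walk (Delete G u v) u v k → 2 ≤ k
detour-length≥2 G uv [] = ⊥-elim (irrefl G uv)
detour-length≥2 G uv (e ∷ []) = ⊥-elim (proj₂ e (inj₁ (refl , refl)))
detour-length≥2 G uv (e ∷ (f ∷ U)) = s≤s (s≤s z≤n)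

-- The detour cycle of an edge uv: a shortest u–v walk P in G − uv closed by uv.
module Detour {n : ℕ} (G : Graph n) {u v : Fin n} (uv : Adj G u v) (D : ℕ)
              (P : Walk (Delete G u v) u v D)
              (P-shortest : ∀ m → Walk (Delete G u v) u v m → D ≤ m) where

  Del : Fin n → Fin n → Set
  Del = Delete G u v

  p : ℕ → Fin n
  p = vertex P

  p-first : p 0 ≡ u
  p-first = vertex-first P

  p-last : p D ≡ v
  p-last = vertex-last P

  -- P is a geodesic of G − uv: splicing a shorter detour from p a to p b into
  -- P would give a u–v walk in G − uv shorter than D.
  geodesic : ∀ {a b q} → a ≤ b → b ≤ D → Walk Del (p a) (p b) q → b ∸ a ≤ q
  geodesic {a} {b} {q} a≤b b≤D Q =
    +-cancelʳ-≤ (D ∸ b) (b ∸ a) q (+-cancelˡ-≤ a _ _ (begin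
      a + ((b ∸ a) + (D ∸ b)) ≡⟨ ≡-sym (+-assoc a (b ∸ a) (D ∸ b)) ⟩
      a + (b ∸ a) + (D ∸ b)   ≡⟨ cong (_+ (D ∸ b)) (m+[n∸m]≡n a≤b) ⟩
      b + (D ∸ b)             ≡⟨ m+[n∸m]≡n b≤D ⟩
      D                       ≤⟨ P-shortest _ spliced ⟩
      a + (q + (D ∸ b))       ∎))
    where
    open ≤-Reasoning
    spliced : Walk Del u v (a + (q + (D ∸ b)))
    spliced = prefix P a (≤-trans a≤b b≤D) ++ʷ Q ++ʷ suffix P b b≤D

  distinct : ∀ {a b} → a < b → b ≤ D → p a ≢ p b
  distinct {a} {b} a<b b≤D pa≡pb =
    <⇒≱ (m<n⇒0<n∸m a<b) (geodesic (<⇒≤ a<b) b≤D (subst (λ z → Walk Del (p a) z 0) pa≡pb []))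

  bound : (i : Fin (suc D)) → toℕ i ≤ D
  bound = toℕ≤pred[n]

  next-inner : (i : Fin (suc D)) → toℕ i < D → toℕ (next i) ≡ suc (toℕ i)
  next-inner i i<D = ≡-trans (toℕ-fromℕ< _) (m<n⇒m%n≡m (s≤s i<D))

  next-last : (i : Fin (suc D)) → toℕ i ≡ D → toℕ (next i) ≡ 0
  next-last i i≡D = ≡-trans (toℕ-fromℕ< _) (≡-trans (cong (λ z → suc z % suc D) i≡D) (n%n≡0 (suc D)))

  last : Fin (suc D)
  last = fromℕ D

  next-of-last : toℕ (next last) ≡ 0
  next-of-last = next-last last (toℕ-fromℕ D)

  position : Fin (suc D) → Fin n
  position i = p (toℕ i)

  -- Consecutive positions are adjacent: along P, or by the closing edge vu.
  position-adj : ∀ i → Adj G (position i) (position (next i))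
  position-adj i with m≤n⇒m<n∨m≡n (bound i)
  ... | inj₁ i<D = subst (λ z → Adj G (position i) (p z)) (≡-sym (next-inner i i<D))
                         (proj₁ (vertex-step P (toℕ i) i<D))
  ... | inj₂ i≡D = subst₂ (Adj G) (≡-trans (≡-sym p-last) (cong p (≡-sym i≡D)))
                          (≡-trans (≡-sym p-first) (cong p (≡-sym (next-last i i≡D)))) (sym G uv)

  position-injective : ∀ {i j} → position i ≡ position j → i ≡ j
  position-injective {i} {j} eq with <-cmp (toℕ i) (toℕ j)
  ... | tri< i<j _ _ = ⊥-elim (distinct i<j (bound j) eq)
  ... | tri≈ _ i≡j _ = toℕ-injective i≡j
  ... | tri> _ _ j<i = ⊥-elim (distinct j<i (bound i) (≡-sym eq))

  cycle : Cycle G (suc D)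
  cycle = record
    { m = D ; len = refl ; three = s≤s (detour-length≥2 G uv P)
    ; vert = position ; inj = position-injective ; adj = position-adj }

  CE : Fin n → Fin n → Set
  CE = CycEdge cycle

  uv-on-cycle : OnCycle cycle u v
  uv-on-cycle = last , inj₂ (≡-trans (cong p (toℕ-fromℕ D)) p-last , ≡-trans (cong p next-of-last) p-first)

  closing : CE (p D) (p 0)
  closing = last , inj₁ (cong p (toℕ-fromℕ D) , cong p next-of-last)

  ce-sym : ∀ {x y} → CE x y → CE y x
  ce-sym (i , inj₁ e) = i , inj₂ e
  ce-sym (i , inj₂ e) = i , inj₁ e

  ce-adj : ∀ {x y} → CE x y → Adj G x y
  ce-adj (i , inj₁ (refl , refl)) = position-adj i
  ce-adj (i , inj₂ (refl , refl)) = sym G (position-adj i)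

  forward-step : ∀ a → a < D → CE (p a) (p (suc a))
  forward-step a a<D = i , inj₁ (cong p (toℕ-fromℕ< _) , cong p next-i)
    where
    i : Fin (suc D)
    i = fromℕ< (s≤s (<⇒≤ a<D))
    next-i : toℕ (next i) ≡ suc a
    next-i = ≡-trans (next-inner i (subst (_< D) (≡-sym (toℕ-fromℕ< _)) a<D)) (cong suc (toℕ-fromℕ< _))

  forward : ∀ a k → a + k ≤ D → Walk CE (p a) (p (a + k)) k
  forward a zero _ rewrite +-identityʳ a = []
  forward a (suc k) a+k<D rewrite +-suc a k =
    forward-step a (≤-trans (s≤s (m≤m+n a k)) a+k<D) ∷ forward (suc a) k a+k<D

  arc-forward : ∀ {a b q} → a ≤ b → b ≤ D → Walk Del (p a) (p b) q → WalkWithin CE (p a) (p b) q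
  arc-forward {a} {b} a≤b b≤D Q =
    b ∸ a , geodesic a≤b b≤D Q ,
    subst (λ c → Walk CE (p a) (p c) (b ∸ a)) (m+[n∸m]≡n a≤b)
          (forward a (b ∸ a) (subst (_≤ D) (≡-sym (m+[n∸m]≡n a≤b)) b≤D))

  arc-within : ∀ {a b q} → a ≤ D → b ≤ D → Walk Del (p a) (p b) q → WalkWithin CE (p a) (p b) q
  arc-within {a} {b} a≤D b≤D Q with ≤-total a b
  ... | inj₁ a≤b = arc-forward a≤b b≤D Q
  ... | inj₂ b≤a with arc-forward b≤a a≤D (reverse (delete-sym G) Q)
  ...   | ℓ , ℓ≤q , W = ℓ , ℓ≤q , reverse ce-sym W

  is-uv? : ∀ x z → Dec ((x ≡ u × z ≡ v) ⊎ (x ≡ v × z ≡ u))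
  is-uv? x z = ((x ≟ᶠ u) ×-dec (z ≟ᶠ v)) ⊎-dec ((x ≟ᶠ v) ×-dec (z ≟ᶠ u))

  -- Main step: a walk U in G ending at p b, preceded by a stretch Q in G − uv
  -- from p a, yields a walk in C from p a to p b that is no longer.  Edges other
  -- than uv extend the stretch; a use of uv ends it at an endpoint of P, where
  -- the stretch becomes an arc, uv becomes the closing edge, and a new stretch starts.
  reroute : ∀ {x y m} → Walk (Adj G) x y m → ∀ {a b q} → a ≤ D → b ≤ D → y ≡ p b →
            Walk Del (p a) x q → WalkWithin CE (p a) (p b) (q + m)
  reroute [] {q = q} a≤D b≤D refl Q with arc-within a≤D b≤D Q
  ... | ℓ , ℓ≤q , W = ℓ , subst (ℓ ≤_) (≡-sym (+-identityʳ q)) ℓ≤q , W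
  reroute {x} (_∷_ {y = z} {k = m} xz U) {q = q} a≤D b≤D y≡pb Q with is-uv? x z
  ... | no not-uv with reroute U a≤D b≤D y≡pb (snoc Q (xz , not-uv))
  ...   | ℓ , ℓ≤ , W = ℓ , subst (ℓ ≤_) (≡-sym (+-suc q m)) ℓ≤ , W
  reroute (xz ∷ U) {a} {q = q} a≤D b≤D y≡pb Q | yes (inj₁ (refl , refl))
    with arc-within a≤D z≤n (subst (λ w → Walk Del (p a) w q) (≡-sym p-first) Q)
       | reroute U ≤-refl b≤D y≡pb (subst (λ w → Walk Del w v 0) (≡-sym p-last) [])
  ... | ℓ₁ , ℓ₁≤ , W₁ | ℓ₂ , ℓ₂≤ , W₂ = ℓ₁ + suc ℓ₂ , +-mono-≤ ℓ₁≤ (s≤s ℓ₂≤) , W₁ ++ʷ ce-sym closing ∷ W₂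
  reroute (xz ∷ U) {a} {q = q} a≤D b≤D y≡pb Q | yes (inj₂ (refl , refl))
    with arc-within a≤D ≤-refl (subst (λ w → Walk Del (p a) w q) (≡-sym p-last) Q)
       | reroute U z≤n b≤D y≡pb (subst (λ w → Walk Del w u 0) (≡-sym p-first) [])
  ... | ℓ₁ , ℓ₁≤ , W₁ | ℓ₂ , ℓ₂≤ , W₂ = ℓ₁ + suc ℓ₂ , +-mono-≤ ℓ₁≤ (s≤s ℓ₂≤) , W₁ ++ʷ closing ∷ W₂

  isometric : Isometric cycle
  isometric _ _ (i , refl) (j , refl) =
    distance-transfer ce-adj (λ U → reroute U (bound i) (bound j) refl [])

edge-on-isometric-cycle : ∀ {n} (G : Graph n) → Bridgeless G → ∀ {u v} → Adj G u v →
  ¬ ¬ (Σ ℕ λ k → Σ (Cycle G k) λ C → Isometric C × OnCycle C u v)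
edge-on-isometric-cycle G bridgeless {u} {v} uv = do
  (k , W) ← (λ no-detour → bridgeless u v (uv , λ k W → no-detour (k , W)))
  (D , P , P-shortest) ← ¬¬-least (Walk (Delete G u v) u v) k W
  let open Detour G uv D P P-shortest
  pure (suc D , cycle , isometric , uv-on-cycle)

edges-in-cycles-up-to-ζ : ∀ {n} (G : Graph n) → Bridgeless G → ∀ L →
  (∀ k → (C : Cycle G k) → Isometric C → k ≤ L) → ¬ ¬ EdgesInCyclesUpTo G L
edges-in-cycles-up-to-ζ {n} G bridgeless L largest =
  ¬¬-Π-Fin n λ u → ¬¬-Π-Fin n λ v → ¬¬-→ λ uv → do
    (k , C , iso , on) ← edge-on-isometric-cycle G bridgeless uv
    pure (k , largest k C iso , C , on)

lemma2 : ∀ {n : ℕ} (G : Graph n) → Bridgeless G → HasEdge G →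
    ∀ (t L : ℕ) → IsEta G t → IsZeta G L → t ≤ L
lemma2 G bridgeless _ t L (_ , η-least) (_ , ζ-largest) =
  decidable-stable (t ≤? L) (¬¬-map (η-least L) (edges-in-cycles-up-to-ζ G bridgeless L ζ-largest))
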